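{- Let $n>d$ and let $\mathcal M$ be a linkage $(n,d)$-matching field on $L\sqcup R$, and fix $\ell_j\in L$. Then the set of graphs $\Omega_\rho^{(j)}$, where $\rho$ ranges over the $(n-d+1)$-subsets of $L$ containing $\ell_j$ and $\Omega_\rho^{(j)}$ is the restriction of the Chow covector $\Omega_\rho$ to $(L\setminus\{\ell_j\})\sqcup R$, is exactly the set of Chow covectors of the induced submatching field of $\mathcal M$ on $(L\setminus\{\ell_j\})\sqcup R$.
   Context: $L=\{\ell_1,\dots,\ell_n\}$, $R=\{r_1,\dots,r_d\}$; graphs are identified with edge sets. An $(n,d)$-matching field $\mathcal M=(M_\sigma)$ assigns to each $d$-subset $\sigma\subseteq L$ a perfect matching $M_\sigma$ on $\sigma\sqcup R$; $M_\sigma(\ell)$ is the partner of $\ell$. It is linkage if for every $(d+1)$-subset $\tau\subseteq L$ the union of the $M_\sigma$ with $\sigma\subset\tau$ is a tree on $\tau\sqcup R$. For a matching field on $L'\sqcup R$ with $|L'|=n'$ and an $(n'-d+1)$-subset $\rho\subseteq L'$, the Chow covector $\Omega_\rho$ has edges $\{(\ell,M_{(L'\setminus\rho)\cup\{\ell\}}(\ell)):\ell\in\rho\}$. The induced submatching field on $(L\setminus\{\ell_j\})\sqcup R$ consists of the matchings $M_\sigma$ with $\ell_j\notin\sigma$. Restricting $\Omega_\rho$ to $(L\setminus\{\ell_j\})\sqcup R$ means deleting $\ell_j$ and its incident edge. -}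

module Defs where

open import Data.Nat using (ℕ; suc; _+_; _∸_; _≤_; _<_)
open import Data.Fin using (Fin)
open import Data.Fin.Subset using (Subset; _∈_; _⊆_; _∪_; _─_; _-_; ⁅_⁆; ∣_∣; ⊤)
open import Data.Sum using (_⊎_; inj₁; inj₂)
open import Data.Product using (_×_; Σ; ∃; ∃-syntax; _,_)
open import Data.List using (List; []; _∷_; _++_; [_]; length)
open import Data.List.Relation.Unary.Linked using (Linked)
open import Data.List.Relation.Unary.Unique.Propositional using (Unique)
open import Data.Empty using (⊥)
open import Data.Unit using () renaming (⊤ to Unit)
open import Relation.Binary.PropositionalEquality using (_≡_; _≢_)
open import Relation.Nullary using (¬_)
open import Function.Bundles using (_⇔_)

-- L = Fin n (left vertices ℓ), R = Fin d (right vertices r).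
-- A bipartite graph on subsets of L ⊔ R, identified with its edge set:
-- G ℓ r holds iff (ℓ , r) is an edge.
Graph : ℕ → ℕ → Set₁
Graph n d = Fin n → Fin d → Set

_≅_ : ∀ {n d} → Graph n d → Graph n d → Set
G ≅ H = ∀ ℓ r → G ℓ r ⇔ H ℓ r

Vertex : ℕ → ℕ → Set
Vertex n d = Fin n ⊎ Fin d

Adj : ∀ {n d} → Graph n d → Vertex n d → Vertex n d → Set
Adj G (inj₁ ℓ) (inj₂ r) = G ℓ r
Adj G (inj₂ r) (inj₁ ℓ) = G ℓ r
Adj G (inj₁ _) (inj₁ _) = ⊥
Adj G (inj₂ _) (inj₂ _) = ⊥

InV : ∀ {n d} → Subset n → Vertex n d → Set
InV τ (inj₁ ℓ) = ℓ ∈ τ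
InV τ (inj₂ r) = Unit

data Walk {n d} (G : Graph n d) : Vertex n d → Vertex n d → Set where
  here : ∀ {u} → Walk G u u
  step : ∀ {u v w} → Adj G u v → Walk G v w → Walk G u w

Cycle : ∀ {n d} → Graph n d → Set
Cycle {n} {d} G = Σ (Vertex n d) λ v → Σ (List (Vertex n d)) λ vs →
  Unique (v ∷ vs) × 3 ≤ length (v ∷ vs) × Linked (Adj G) (v ∷ vs ++ [ v ])

IsTreeOn : ∀ {n d} → Subset n → Graph n d → Set
IsTreeOn {n} {d} τ G =
  (∀ ℓ r → G ℓ r → ℓ ∈ τ)
  × (∀ (u v : Vertex n d) → InV τ u → InV τ v → Walk G u v)
  × ¬ Cycle G

-- A matching field: to each subset σ ⊆ L a partner function
-- M σ : L → R; only its values for d-subsets σ and ℓ ∈ σ matter.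
-- The matching M_σ has edge set {(ℓ , M σ ℓ) : ℓ ∈ σ}.
MatchingFieldData : ℕ → ℕ → Set
MatchingFieldData n d = Subset n → Fin n → Fin d

MatchingGraph : ∀ {n d} → MatchingFieldData n d → Subset n → Graph n d
MatchingGraph M σ ℓ r = ℓ ∈ σ × M σ ℓ ≡ r

-- M is an (|A|, d)-matching field on A ⊔ R (A ⊆ L): for every d-subset
-- σ ⊆ A, ℓ ↦ M σ ℓ is injective on σ, hence (|σ| = |R| = d) a perfect
-- matching of σ ⊔ R.
IsMatchingField : ∀ {n d} → Subset n → MatchingFieldData n d → Set
IsMatchingField {n} {d} A M = ∀ (σ : Subset n) → σ ⊆ A → ∣ σ ∣ ≡ d →
  ∀ ℓ ℓ′ → ℓ ∈ σ → ℓ′ ∈ σ → M σ ℓ ≡ M σ ℓ′ → ℓ ≡ ℓ′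

UnionGraph : ∀ {n d} → MatchingFieldData n d → Subset n → Graph n d
UnionGraph {n} {d} M τ ℓ r =
  ∃[ σ ] (σ ⊆ τ × ∣ σ ∣ ≡ d × MatchingGraph M σ ℓ r)

IsLinkage : ∀ {n d} → Subset n → MatchingFieldData n d → Set
IsLinkage {n} {d} A M = ∀ (τ : Subset n) → τ ⊆ A → ∣ τ ∣ ≡ suc d →
  IsTreeOn τ (UnionGraph M τ)

ChowCovector : ∀ {n d} → MatchingFieldData n d → Subset n → Subset n → Graph n d
ChowCovector M A ρ ℓ r = ℓ ∈ ρ × M ((A ─ ρ) ∪ ⁅ ℓ ⁆) ℓ ≡ r

IsChowIndex : ∀ {n} → ℕ → Subset n → Subset n → Set
IsChowIndex d A ρ = ρ ⊆ A × ∣ ρ ∣ ≡ ∣ A ∣ ∸ d + 1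

Restrict : ∀ {n d} → Fin n → Graph n d → Graph n d
Restrict j G ℓ r = ℓ ≢ j × G ℓ r

module Submission where

-- The argument is purely set-theoretic: deleting j is a bijection
--   ρ ↦ ρ - j  (inverse  ρ′ ↦ ρ′ ∪ {j})
-- between Chow indices of A containing j and Chow indices of A - j, and it
-- does not change the complement, since (A - j) ∖ (ρ - j) = A ∖ ρ.  The
-- complement is all a Chow covector reads off besides ρ itself, so the
-- restricted covector at ρ equals the covector of A - j at ρ - j.

open import Defs
open import Data.Nat using (ℕ; _<_)
open import Data.Fin using (Fin)
open import Data.Fin.Subset using (Subset; _∈_; _-_; ⊤)
open import Data.Product using (_×_; ∃-syntax)

open import Data.Nat using (suc; _∸_; _+_; _≤_)
open import Data.Nat.Properties using (suc-injective; +-∸-assoc; ≤-pred)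
open import Data.Fin using (zero; suc)
open import Data.Fin.Properties using (_≟_)
open import Data.Fin.Subset using (_─_; _∪_; ⁅_⁆; ∣_∣; _∉_; _⊆_; inside; outside)
open import Data.Fin.Subset.Properties
  using (x∈p∧x≢y⇒x∈p-y; p─q⊆p; p─⊥≡p; ∪-identityʳ; x∈p∪q⁺; x∈⁅x⁆; ∈⊤; ∣⊤∣≡n)
open import Data.Vec using (_∷_; _[_]=_)
open _[_]=_
open import Data.Product using (_,_)
open import Data.Sum using (inj₂)
open import Relation.Binary.PropositionalEquality
  using (_≡_; _≢_; refl; sym; trans; cong; subst)
open import Relation.Nullary using (yes; no; contradiction)
open import Function.Bundles using (_⇔_; mk⇔; Equivalence)

∈-delete⇒≢ : ∀ {n} (p : Subset n) (y x : Fin n) → x ∈ p - y → x ≢ y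
∈-delete⇒≢ (_ ∷ p) zero    (suc x) _         ()
∈-delete⇒≢ (_ ∷ p) (suc y) zero    _         ()
∈-delete⇒≢ (_ ∷ p) (suc y) (suc x) (there h) refl = ∈-delete⇒≢ p y x h refl

∣p-x∣+1≡∣p∣ : ∀ {n} (p : Subset n) (x : Fin n) → x ∈ p → suc ∣ p - x ∣ ≡ ∣ p ∣
∣p-x∣+1≡∣p∣ (inside  ∷ p) zero    here      = cong (λ q → suc ∣ q ∣) (p─⊥≡p p)
∣p-x∣+1≡∣p∣ (inside  ∷ p) (suc x) (there h) = cong suc (∣p-x∣+1≡∣p∣ p x h)
∣p-x∣+1≡∣p∣ (outside ∷ p) (suc x) (there h) = ∣p-x∣+1≡∣p∣ p x h

-- Deleting a member x of q from both p and q leaves the difference p ∖ q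
-- unchanged: x was removed from p ∖ q anyway.
delete-─ : ∀ {n} (p q : Subset n) (x : Fin n) → x ∈ q → (p - x) ─ (q - x) ≡ p ─ q
delete-─ (s ∷ p) (inside ∷ q) zero here =
  cong (outside ∷_) (trans (cong ((p ─ _) ─_) (p─⊥≡p q)) (cong (_─ q) (p─⊥≡p p)))
delete-─ (inside  ∷ p) (inside  ∷ q) (suc x) (there h) = cong (outside ∷_) (delete-─ p q x h)
delete-─ (inside  ∷ p) (outside ∷ q) (suc x) (there h) = cong (inside  ∷_) (delete-─ p q x h)
delete-─ (outside ∷ p) (inside  ∷ q) (suc x) (there h) = cong (outside ∷_) (delete-─ p q x h)
delete-─ (outside ∷ p) (outside ∷ q) (suc x) (there h) = cong (outside ∷_) (delete-─ p q x h)

insert-delete : ∀ {n} (p : Subset n) (x : Fin n) → x ∉ p → (p ∪ ⁅ x ⁆) - x ≡ p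
insert-delete (inside  ∷ p) zero    x∉p = contradiction here x∉p
insert-delete (outside ∷ p) zero    _   =
  cong (outside ∷_) (trans (cong (_─ _) (∪-identityʳ p)) (p─⊥≡p p))
insert-delete (inside  ∷ p) (suc x) x∉p =
  cong (inside ∷_) (insert-delete p x (λ h → x∉p (there h)))
insert-delete (outside ∷ p) (suc x) x∉p =
  cong (outside ∷_) (insert-delete p x (λ h → x∉p (there h)))

delete-⊆⁻ : ∀ {n} {p q : Subset n} {x : Fin n} → x ∈ q → p - x ⊆ q - x → p ⊆ q
delete-⊆⁻ {p = p} {q} {x} x∈q p-x⊆q-x {y} y∈p with y ≟ x
... | yes refl = x∈q
... | no  y≢x  = p─q⊆p q _ (p-x⊆q-x (x∈p∧x≢y⇒x∈p-y y∈p y≢x))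

chowSize-delete : ∀ {d r a} → d ≤ a → (suc r ≡ suc a ∸ d + 1) ⇔ (r ≡ a ∸ d + 1)
chowSize-delete {d} {r} {a} d≤a = mk⇔
  (λ e → suc-injective (trans e shift))
  (λ e → trans (cong suc e) (sym shift))
  where
  shift : suc a ∸ d + 1 ≡ suc (a ∸ d + 1)
  shift = cong (_+ 1) (+-∸-assoc 1 d≤a)

chowIndex-delete : ∀ {n} d (A ρ : Subset n) (j : Fin n) → j ∈ A → d < ∣ A ∣ →
  j ∈ ρ → IsChowIndex d A ρ ⇔ IsChowIndex d (A - j) (ρ - j)
chowIndex-delete d A ρ j j∈A d<∣A∣ j∈ρ = mk⇔
  (λ { (ρ⊆A , size) →
         (λ {x} x∈ρ-j → x∈p∧x≢y⇒x∈p-y (ρ⊆A (p─q⊆p ρ _ x∈ρ-j)) (∈-delete⇒≢ ρ j x x∈ρ-j))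
       , Equivalence.to (chowSize-delete d≤∣A-j∣) (size-down size) })
  (λ { (ρ-j⊆A-j , size) →
         delete-⊆⁻ j∈A ρ-j⊆A-j
       , size-up (Equivalence.from (chowSize-delete d≤∣A-j∣) size) })
  where
  ∣A∣≡ : suc ∣ A - j ∣ ≡ ∣ A ∣
  ∣A∣≡ = ∣p-x∣+1≡∣p∣ A j j∈A
  ∣ρ∣≡ : suc ∣ ρ - j ∣ ≡ ∣ ρ ∣
  ∣ρ∣≡ = ∣p-x∣+1≡∣p∣ ρ j j∈ρ
  d≤∣A-j∣ : d ≤ ∣ A - j ∣
  d≤∣A-j∣ = ≤-pred (subst (suc d ≤_) (sym ∣A∣≡) d<∣A∣)
  size-down : ∣ ρ ∣ ≡ ∣ A ∣ ∸ d + 1 → suc ∣ ρ - j ∣ ≡ suc ∣ A - j ∣ ∸ d + 1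
  size-down e = trans ∣ρ∣≡ (trans e (cong (λ k → k ∸ d + 1) (sym ∣A∣≡)))
  size-up : suc ∣ ρ - j ∣ ≡ suc ∣ A - j ∣ ∸ d + 1 → ∣ ρ ∣ ≡ ∣ A ∣ ∸ d + 1
  size-up e = trans (sym ∣ρ∣≡) (trans e (cong (λ k → k ∸ d + 1) ∣A∣≡))

-- Deleting j ∈ ρ commutes with taking Chow covectors: the restriction of
-- Ω_ρ to (L ∖ {j}) ⊔ R is the Chow covector of A - j at ρ - j, because
-- both read M at the same subsets (A ∖ ρ) ∪ {ℓ}.
restrict-chowCovector : ∀ {n d} (M : MatchingFieldData n d) (A ρ : Subset n)
  (j : Fin n) → j ∈ ρ →
  Restrict j (ChowCovector M A ρ) ≅ ChowCovector M (A - j) (ρ - j)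
restrict-chowCovector {n} M A ρ j j∈ρ ℓ r = mk⇔
  (λ { (ℓ≢j , ℓ∈ρ , e) → x∈p∧x≢y⇒x∈p-y ℓ∈ρ ℓ≢j , subst (partnerIs ℓ) (sym same) e })
  (λ { (ℓ∈ρ-j , e) → ∈-delete⇒≢ ρ j ℓ ℓ∈ρ-j , p─q⊆p ρ _ ℓ∈ρ-j , subst (partnerIs ℓ) same e })
  where
  same : (A - j) ─ (ρ - j) ≡ A ─ ρ
  same = delete-─ A ρ j j∈ρ
  partnerIs : Fin n → Subset n → Set
  partnerIs ℓ C = M (C ∪ ⁅ ℓ ⁆) ℓ ≡ r

lemma3p26 : (n d : ℕ) → d < n → (M : MatchingFieldData n d) →
    IsMatchingField ⊤ M → IsLinkage ⊤ M → (j : Fin n) →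
    ((ρ : Subset n) → IsChowIndex d ⊤ ρ → j ∈ ρ →
      ∃[ ρ′ ] (IsChowIndex d (⊤ - j) ρ′ ×
        (Restrict j (ChowCovector M ⊤ ρ) ≅ ChowCovector M (⊤ - j) ρ′)))
    × ((ρ′ : Subset n) → IsChowIndex d (⊤ - j) ρ′ →
      ∃[ ρ ] (IsChowIndex d ⊤ ρ × j ∈ ρ ×
        (Restrict j (ChowCovector M ⊤ ρ) ≅ ChowCovector M (⊤ - j) ρ′)))
lemma3p26 n d d<n M _ _ j = restrictions , extensions
  where
  d<∣⊤∣ : d < ∣ ⊤ {n} ∣
  d<∣⊤∣ = subst (d <_) (sym (∣⊤∣≡n n)) d<n

  index⇔ : ∀ ρ → j ∈ ρ → IsChowIndex d ⊤ ρ ⇔ IsChowIndex d (⊤ - j) (ρ - j)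
  index⇔ ρ = chowIndex-delete d ⊤ ρ j ∈⊤ d<∣⊤∣

  Matches : Subset n → Subset n → Set
  Matches ρ σ = Restrict j (ChowCovector M ⊤ ρ) ≅ ChowCovector M (⊤ - j) σ

  restrictions : (ρ : Subset n) → IsChowIndex d ⊤ ρ → j ∈ ρ →
    ∃[ ρ′ ] (IsChowIndex d (⊤ - j) ρ′ × Matches ρ ρ′)
  restrictions ρ idx j∈ρ =
    ρ - j , Equivalence.to (index⇔ ρ j∈ρ) idx , restrict-chowCovector M ⊤ ρ j j∈ρ

  extensions : (ρ′ : Subset n) → IsChowIndex d (⊤ - j) ρ′ →
    ∃[ ρ ] (IsChowIndex d ⊤ ρ × j ∈ ρ × Matches ρ ρ′)
  extensions ρ′ idx′@(ρ′⊆⊤-j , _) =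
      ρ′ ∪ ⁅ j ⁆
    , Equivalence.from (index⇔ (ρ′ ∪ ⁅ j ⁆) j∈ρ) (subst (IsChowIndex d (⊤ - j)) (sym ρ-j≡ρ′) idx′)
    , j∈ρ
    , subst (Matches (ρ′ ∪ ⁅ j ⁆)) ρ-j≡ρ′ (restrict-chowCovector M ⊤ (ρ′ ∪ ⁅ j ⁆) j j∈ρ)
    where
    j∉ρ′ : j ∉ ρ′
    j∉ρ′ j∈ρ′ = ∈-delete⇒≢ ⊤ j j (ρ′⊆⊤-j j∈ρ′) refl
    j∈ρ : j ∈ ρ′ ∪ ⁅ j ⁆
    j∈ρ = x∈p∪q⁺ (inj₂ (x∈⁅x⁆ j))
    ρ-j≡ρ′ : (ρ′ ∪ ⁅ j ⁆) - j ≡ ρ′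
    ρ-j≡ρ′ = insert-delete ρ′ j j∉ρ′
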